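{- Let $k\ge0$ and let $\pi^\varepsilon$ be a peg permutation of length $k+2$ in the clean compact peg basis of $\hat B_k^{(prd)}$. Suppose $\beta^b=\beta_1^{b_1}\cdots\beta_{k+1}^{b_{k+1}}$ is obtained from $\pi^\varepsilon$ by deleting one entry (keeping the other decorations) and standardizing the values to $\{1,\dots,k+1\}$. If $\beta^b$ is clean compact, then $\beta_{k+1}=k+1$ and $b_{k+1}\in\{+,\bullet\}$.
   Context: A peg permutation of length $n$ is a word $\pi_1^{\varepsilon_1}\cdots\pi_n^{\varepsilon_n}$ with $\pi_1\cdots\pi_n$ a permutation of $\{1,\dots,n\}$ in one-line notation and $\varepsilon_i\in\{+,-,\bullet\}$. An increasing (resp. decreasing) strip is a maximal factor of consecutive positions in which each value is one more (resp. one less) than the previous and all entries are decorated $+$ or $\bullet$ (resp. $-$ or $\bullet$); clean compact means all strips have length $1$. A prefix reversal reverses a prefix and swaps $+\leftrightarrow-$ on the reversed entries ($\bullet$ unchanged); $prd(\pi^\varepsilon)$ is the minimum number of prefix reversals turning $\pi^\varepsilon$ into a peg permutation with identity underlying permutation and decorations in $\{+,\bullet\}$; $\hat B_k^{(prd)}$ is the set of peg permutations with $prd\le k$. Peg pattern order: $\sigma^\delta$ of length $m$ is a pattern of $\tau^\varepsilon$ if there are $i_1<\dots<i_m$ with $\tau_{i_1}\cdots\tau_{i_m}$ order-isomorphic to $\sigma$ and, for each $j$, $\delta_j\in\{+,-\}$ implies $\varepsilon_{i_j}=\delta_j$. The clean compact peg basis of a pattern-closed set $X$ is the set of clean compact peg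 permutations not in $X$ all of whose proper clean compact patterns lie in $X$. -}

module Defs where

open import Data.Nat using (ℕ; zero; suc; _<_; _≤_; _<?_)
open import Data.Nat.Properties using ()
open import Data.List using (List; []; _∷_; map; length; reverse; take; drop; _++_; filter; applyUpTo; removeAt; foldl; zip)
open import Data.List.Relation.Unary.All using (All)
open import Data.List.Relation.Binary.Pointwise using (Pointwise)
open import Data.List.Relation.Binary.Permutation.Propositional using (_↭_)
open import Data.List.Relation.Binary.Sublist.Propositional using (_⊆_)
open import Data.Product using (_×_; _,_; proj₁; proj₂; ∃; ∃-syntax)
open import Data.Sum using (_⊎_)
open import Relation.Binary.PropositionalEquality using (_≡_; _≢_)
open import Relation.Nullary using (¬_)
open import Data.Unit using (⊤)
open import Data.Fin using (Fin)

data Deco : Set where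
  plus minus dot : Deco

-- A decorated word: list of (value , decoration), values intended in {1..n}
Word : Set
Word = List (ℕ × Deco)

vals : Word → List ℕ
vals = map proj₁

decs : Word → List Deco
decs = map proj₂

oneTo : ℕ → List ℕ
oneTo n = applyUpTo suc n

IsPeg : Word → Set
IsPeg w = vals w ↭ oneTo (length w)

-- decoration allowed in an increasing / decreasing strip
IncDec : Deco → Set
IncDec d = d ≢ minus

DecDec : Deco → Set
DecDec d = d ≢ plus

-- two adjacent entries lying in a common (increasing or decreasing) strip
Bond : ℕ × Deco → ℕ × Deco → Set
Bond (a , d) (b , e) =
  (b ≡ suc a × IncDec d × IncDec e) ⊎ (a ≡ suc b × DecDec d × DecDec e)

-- clean compact: every strip has length 1, i.e. no two adjacent entries form a strip
CleanCompact : Word → Set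
CleanCompact []              = ⊤
CleanCompact (x ∷ [])        = ⊤
CleanCompact (x ∷ y ∷ w)     = ¬ Bond x y × CleanCompact (y ∷ w)

flipD : Deco → Deco
flipD plus  = minus
flipD minus = plus
flipD dot   = dot

flipE : ℕ × Deco → ℕ × Deco
flipE (a , d) = (a , flipD d)

prefRev : ℕ → Word → Word
prefRev i w = map flipE (reverse (take i w)) ++ drop i w

applyRevs : Word → List ℕ → Word
applyRevs = foldl (λ w i → prefRev i w)

Sorted : Word → Set
Sorted w = vals w ≡ oneTo (length w) × All IncDec (decs w)

PrdLe : ℕ → Word → Set
PrdLe k w = ∃[ is ] (length is ≤ k × Sorted (applyRevs w is))

InB : ℕ → Word → Set
InB k w = IsPeg w × PrdLe k w

rank : List ℕ → ℕ → ℕ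
rank u x = length (filter (_<? x) u)

std : List ℕ → List ℕ
std u = map (λ x → suc (rank u x)) u

DecoOK : Deco → Deco → Set
DecoOK plus  e = e ≡ plus
DecoOK minus e = e ≡ minus
DecoOK dot   e = ⊤

-- σ^δ is a pattern of τ^ε: a subsequence of τ order-isomorphic to σ
-- (equal standardizations) with compatible decorations
IsPattern : Word → Word → Set
IsPattern σ τ = ∃[ u ] (u ⊆ τ × std (vals u) ≡ std (vals σ) × Pointwise DecoOK (decs σ) (decs u))

InCCBasis : ℕ → Word → Set
InCCBasis k π =
  IsPeg π × CleanCompact π × ¬ InB k π ×
  (∀ σ → IsPeg σ → CleanCompact σ → IsPattern σ π → σ ≢ π → InB k σ)

deleteStd : (w : Word) → Fin (length w) → Word
deleteStd w i = zip (std (vals w')) (decs w')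
  where
    w' = removeAt w i

-- Every proper clean compact pattern of a basis element lies in the class, so deleting an
-- entry of π gives a clean compact σ of length k + 1 that at most k prefix reversals sort.
-- Count the bonds (adjacent pairs inside a strip) of σ followed by a sentinel entry (k + 2)⁺.
-- Reversing and flipping a prefix preserves its internal bonds, so a prefix reversal creates
-- at most one bond, at the junction after the prefix; the sorted word followed by the
-- sentinel has k + 1 bonds.  Hence σ followed by the sentinel has a bond; as σ is clean
-- compact it can only be the last one, which forces σ to end in (k + 1)⁺ or (k + 1)•.
module Submission where

open import Defs
open import Data.Bool using (true; false; if_then_else_)
open import Data.Empty using (⊥-elim)
open import Data.Fin as Fin using (Fin)
open import Data.List using (List; length; _∷_; []; _++_; _∷ʳ_; map; reverse; take; drop; applyUpTo; removeAt; zip)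
open import Data.List.Properties
open import Data.List.Membership.Propositional using (_∈_)
open import Data.List.Relation.Binary.Permutation.Propositional using (_↭_; ↭-sym; ↭-trans; ↭-reflexive; ↭⇒↭ₛ)
open import Data.List.Relation.Binary.Permutation.Propositional.Properties using (map⁺; ↭-length; filter-↭)
open import Data.List.Relation.Binary.Permutation.Setoid.Properties using (Unique-resp-↭)
open import Data.List.Relation.Binary.Pointwise using (Pointwise)
import Data.List.Relation.Binary.Pointwise as Pointwise
open import Data.List.Relation.Binary.Sublist.Propositional as Sublist using (_⊆_; _∷_; ⊆-refl)
open import Data.List.Relation.Binary.Sublist.Propositional.Properties using (filter⁺; length-mono-≤)
open import Data.List.Relation.Unary.All as All using (All; []; _∷_)
open import Data.List.Relation.Unary.All.Properties using (++⁺)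
open import Data.List.Relation.Unary.AllPairs as AllPairs using (AllPairs; []; _∷_)
open import Data.List.Relation.Unary.Any using (here; there)
open import Data.List.Relation.Unary.Linked.Properties using (Linked⇒AllPairs)
open import Data.List.Relation.Unary.Unique.Propositional using (Unique)
open import Data.List.Relation.Unary.Unique.Propositional.Properties using (applyUpTo⁺₁)
open import Data.Nat using (ℕ; zero; suc; _+_; _<_; _≤_; z≤n; s≤s; pred)
open import Data.Nat.Properties
open import Data.List.Sort ≤-decTotalOrder using (sort; sort-↭; sort-↗)
open import Data.Product using (_×_; _,_; proj₁; proj₂; uncurry; ∃-syntax)
open import Data.Sum using (inj₁; inj₂)
open import Function using (_∘_)
open import Function.Bundles using (_⇔_; mk⇔; Equivalence)
open import Relation.Binary.PropositionalEquality
open import Relation.Nullary using (¬_; Dec; yes; no; does; _×-dec_; _⊎-dec_)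
open import Relation.Nullary.Decidable using (dec-true; dec-false; does-⇔)

incDec? : ∀ d → Dec (IncDec d)
incDec? plus  = yes λ ()
incDec? minus = no λ h → h refl
incDec? dot   = yes λ ()

decDec? : ∀ d → Dec (DecDec d)
decDec? plus  = no λ h → h refl
decDec? minus = yes λ ()
decDec? dot   = yes λ ()

bond? : ∀ x y → Dec (Bond x y)
bond? (a , d) (b , e) =
  (b ≟ suc a ×-dec incDec? d ×-dec incDec? e) ⊎-dec (a ≟ suc b ×-dec decDec? d ×-dec decDec? e)

incDec-flipD : ∀ d → IncDec (flipD d) ⇔ DecDec d
incDec-flipD plus  = mk⇔ (λ h → ⊥-elim (h refl)) (λ h → ⊥-elim (h refl))
incDec-flipD minus = mk⇔ (λ _ ()) (λ _ ())
incDec-flipD dot   = mk⇔ (λ _ ()) (λ _ ())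

decDec-flipD : ∀ d → DecDec (flipD d) ⇔ IncDec d
decDec-flipD plus  = mk⇔ (λ _ ()) (λ _ ())
decDec-flipD minus = mk⇔ (λ h → ⊥-elim (h refl)) (λ h → ⊥-elim (h refl))
decDec-flipD dot   = mk⇔ (λ _ ()) (λ _ ())

bond-flipE : ∀ x y → Bond (flipE y) (flipE x) ⇔ Bond x y
bond-flipE (a , d) (b , e) = mk⇔ unflip flip
  where
  open Equivalence
  unflip : Bond (b , flipD e) (a , flipD d) → Bond (a , d) (b , e)
  unflip (inj₁ (a≡ , ie , id)) = inj₂ (a≡ , to (incDec-flipD d) id , to (incDec-flipD e) ie)
  unflip (inj₂ (b≡ , de , dd)) = inj₁ (b≡ , to (decDec-flipD d) dd , to (decDec-flipD e) de)
  flip : Bond (a , d) (b , e) → Bond (b , flipD e) (a , flipD d)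
  flip (inj₁ (b≡ , id , ie)) = inj₂ (b≡ , from (decDec-flipD e) ie , from (decDec-flipD d) id)
  flip (inj₂ (a≡ , dd , de)) = inj₁ (a≡ , from (incDec-flipD e) de , from (incDec-flipD d) dd)

bondCount : ℕ × Deco → ℕ × Deco → ℕ
bondCount x y = if does (bond? x y) then 1 else 0

bondCount-yes : ∀ {x y} → Bond x y → bondCount x y ≡ 1
bondCount-yes {x} {y} b rewrite dec-true (bond? x y) b = refl

bondCount-no : ∀ {x y} → ¬ Bond x y → bondCount x y ≡ 0
bondCount-no {x} {y} nb rewrite dec-false (bond? x y) nb = refl

bondCount-positive : ∀ x y → 0 < bondCount x y → Bond x y
bondCount-positive x y pos with bond? x y
... | yes b  = b
... | no ¬b = ⊥-elim (n≮n 0 (subst (0 <_) (bondCount-no ¬b) pos))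

bondCount≤1 : ∀ x y → bondCount x y ≤ 1
bondCount≤1 x y with does (bond? x y)
... | true  = ≤-refl
... | false = z≤n

bondCount-flipE : ∀ x y → bondCount (flipE y) (flipE x) ≡ bondCount x y
bondCount-flipE x y =
  cong (λ b → if b then 1 else 0) (does-⇔ (bond-flipE x y) (bond? (flipE y) (flipE x)) (bond? x y))

bonds : Word → ℕ
bonds []          = 0
bonds (x ∷ [])    = 0
bonds (x ∷ y ∷ w) = bondCount x y + bonds (y ∷ w)

bonds-∷-≥ : ∀ x w → bonds w ≤ bonds (x ∷ w)
bonds-∷-≥ x []      = z≤n
bonds-∷-≥ x (y ∷ w) = m≤n+m (bonds (y ∷ w)) (bondCount x y)

bonds-∷-≤ : ∀ x w → bonds (x ∷ w) ≤ suc (bonds w)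
bonds-∷-≤ x []      = z≤n
bonds-∷-≤ x (y ∷ w) = +-monoˡ-≤ (bonds (y ∷ w)) (bondCount≤1 x y)

bonds-++-≥ : ∀ u v → bonds u + bonds v ≤ bonds (u ++ v)
bonds-++-≥ []          v = ≤-refl
bonds-++-≥ (x ∷ [])    v = bonds-∷-≥ x v
bonds-++-≥ (x ∷ y ∷ u) v = begin
  bondCount x y + bonds (y ∷ u) + bonds v   ≡⟨ +-assoc (bondCount x y) _ _ ⟩
  bondCount x y + (bonds (y ∷ u) + bonds v) ≤⟨ +-monoʳ-≤ (bondCount x y) (bonds-++-≥ (y ∷ u) v) ⟩
  bondCount x y + bonds (y ∷ u ++ v)        ∎
  where open ≤-Reasoning

bonds-++-≤ : ∀ u v → bonds (u ++ v) ≤ suc (bonds u + bonds v)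
bonds-++-≤ []          v = n≤1+n (bonds v)
bonds-++-≤ (x ∷ [])    v = bonds-∷-≤ x v
bonds-++-≤ (x ∷ y ∷ u) v = begin
  bondCount x y + bonds (y ∷ u ++ v)              ≤⟨ +-monoʳ-≤ (bondCount x y) (bonds-++-≤ (y ∷ u) v) ⟩
  bondCount x y + suc (bonds (y ∷ u) + bonds v)   ≡⟨ +-suc (bondCount x y) _ ⟩
  suc (bondCount x y + (bonds (y ∷ u) + bonds v)) ≡⟨ cong suc (+-assoc (bondCount x y) _ _) ⟨
  suc (bondCount x y + bonds (y ∷ u) + bonds v)   ∎
  where open ≤-Reasoning

bonds-∷ʳ-∷ʳ : ∀ u y z → bonds (u ∷ʳ y ∷ʳ z) ≡ bonds (u ∷ʳ y) + bondCount y z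
bonds-∷ʳ-∷ʳ []          y z = +-identityʳ (bondCount y z)
bonds-∷ʳ-∷ʳ (x ∷ [])    y z = begin
  bondCount x y + (bondCount y z + 0) ≡⟨ cong (bondCount x y +_) (+-identityʳ _) ⟩
  bondCount x y + bondCount y z       ≡⟨ cong (_+ bondCount y z) (+-identityʳ _) ⟨
  bondCount x y + 0 + bondCount y z   ∎
  where open ≡-Reasoning
bonds-∷ʳ-∷ʳ (x ∷ x′ ∷ u) y z = begin
  bondCount x x′ + bonds (x′ ∷ u ∷ʳ y ∷ʳ z)                 ≡⟨ cong (bondCount x x′ +_) (bonds-∷ʳ-∷ʳ (x′ ∷ u) y z) ⟩
  bondCount x x′ + (bonds (x′ ∷ u ∷ʳ y) + bondCount y z)    ≡⟨ +-assoc (bondCount x x′) _ _ ⟨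
  bondCount x x′ + bonds (x′ ∷ u ∷ʳ y) + bondCount y z      ∎
  where open ≡-Reasoning

flipRev : Word → Word
flipRev w = map flipE (reverse w)

flipRev-∷ : ∀ x w → flipRev (x ∷ w) ≡ flipRev w ∷ʳ flipE x
flipRev-∷ x w = trans (cong (map flipE) (unfold-reverse x w)) (map-++ flipE (reverse w) (x ∷ []))

bonds-flipRev : ∀ w → bonds (flipRev w) ≡ bonds w
bonds-flipRev []          = refl
bonds-flipRev (x ∷ [])    = refl
bonds-flipRev (x ∷ y ∷ w) = begin
  bonds (flipRev (x ∷ y ∷ w))                                ≡⟨ cong bonds (flipRev-∷ x (y ∷ w)) ⟩
  bonds (flipRev (y ∷ w) ∷ʳ flipE x)                         ≡⟨ cong (λ u → bonds (u ∷ʳ flipE x)) (flipRev-∷ y w) ⟩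
  bonds (flipRev w ∷ʳ flipE y ∷ʳ flipE x)                    ≡⟨ bonds-∷ʳ-∷ʳ (flipRev w) (flipE y) (flipE x) ⟩
  bonds (flipRev w ∷ʳ flipE y) + bondCount (flipE y) (flipE x) ≡⟨ cong₂ _+_ (cong bonds (sym (flipRev-∷ y w))) (bondCount-flipE x y) ⟩
  bonds (flipRev (y ∷ w)) + bondCount x y                    ≡⟨ cong (_+ bondCount x y) (bonds-flipRev (y ∷ w)) ⟩
  bonds (y ∷ w) + bondCount x y                              ≡⟨ +-comm (bonds (y ∷ w)) (bondCount x y) ⟩
  bondCount x y + bonds (y ∷ w)                              ∎
  where open ≡-Reasoning

bondsBefore : ℕ → Word → ℕ
bondsBefore s w = bonds (w ∷ʳ (s , plus))

bondsBefore-prefRev : ∀ s j w → bondsBefore s (prefRev j w) ≤ suc (bondsBefore s w)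
bondsBefore-prefRev s j w = begin
  bonds ((flipRev t ++ drop j w) ∷ʳ (s , plus)) ≡⟨ cong bonds (++-assoc (flipRev t) (drop j w) _) ⟩
  bonds (flipRev t ++ r)                        ≤⟨ bonds-++-≤ (flipRev t) r ⟩
  suc (bonds (flipRev t) + bonds r)             ≡⟨ cong (λ b → suc (b + bonds r)) (bonds-flipRev t) ⟩
  suc (bonds t + bonds r)                       ≤⟨ s≤s (bonds-++-≥ t r) ⟩
  suc (bonds (t ++ r))                          ≡⟨ cong (suc ∘ bonds) (++-assoc t (drop j w) _) ⟨
  suc (bonds ((t ++ drop j w) ∷ʳ (s , plus)))   ≡⟨ cong (λ u → suc (bonds (u ∷ʳ (s , plus)))) (take++drop≡id j w) ⟩
  suc (bonds (w ∷ʳ (s , plus)))                 ∎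
  where
  open ≤-Reasoning
  t = take j w
  r = drop j w ∷ʳ (s , plus)

bondsBefore-applyRevs : ∀ s w is → bondsBefore s (applyRevs w is) ≤ length is + bondsBefore s w
bondsBefore-applyRevs s w []       = ≤-refl
bondsBefore-applyRevs s w (j ∷ is) = begin
  bondsBefore s (applyRevs (prefRev j w) is) ≤⟨ bondsBefore-applyRevs s (prefRev j w) is ⟩
  length is + bondsBefore s (prefRev j w)    ≤⟨ +-monoʳ-≤ (length is) (bondsBefore-prefRev s j w) ⟩
  length is + suc (bondsBefore s w)          ≡⟨ +-suc (length is) _ ⟩
  suc (length is + bondsBefore s w)          ∎
  where open ≤-Reasoning

length-flipRev : ∀ w → length (flipRev w) ≡ length w
length-flipRev w = trans (length-map flipE (reverse w)) (length-reverse w)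

length-prefRev : ∀ j w → length (prefRev j w) ≡ length w
length-prefRev j w = begin
  length (flipRev (take j w) ++ drop j w)          ≡⟨ length-++ (flipRev (take j w)) ⟩
  length (flipRev (take j w)) + length (drop j w)  ≡⟨ cong (_+ length (drop j w)) (length-flipRev (take j w)) ⟩
  length (take j w) + length (drop j w)            ≡⟨ length-++ (take j w) ⟨
  length (take j w ++ drop j w)                    ≡⟨ cong length (take++drop≡id j w) ⟩
  length w                                         ∎
  where open ≡-Reasoning

length-applyRevs : ∀ w is → length (applyRevs w is) ≡ length w
length-applyRevs w []       = refl
length-applyRevs w (j ∷ is) = trans (length-applyRevs (prefRev j w) is) (length-prefRev j w)

bonds-increasingRun : ∀ (f : ℕ → ℕ) → (∀ i → f (suc i) ≡ suc (f i)) →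
                      ∀ n w → vals w ≡ applyUpTo f (suc n) → All IncDec (decs w) → bonds w ≡ n
bonds-increasingRun f f-suc zero    (x ∷ [])    _  _ = refl
bonds-increasingRun f f-suc zero    (x ∷ y ∷ w) () _
bonds-increasingRun f f-suc (suc n) (x ∷ [])    () _
bonds-increasingRun f f-suc (suc n) ((a , d) ∷ (b , e) ∷ w) eq (inc-d ∷ inc-e ∷ inc-w) =
  cong₂ _+_ (bondCount-yes (inj₁ (b≡1+a , inc-d , inc-e)))
            (bonds-increasingRun (f ∘ suc) (f-suc ∘ suc) n ((b , e) ∷ w) tail-eq (inc-e ∷ inc-w))
  where
  tail-eq = proj₂ (∷-injective eq)
  b≡1+a : b ≡ suc a
  b≡1+a = trans (proj₁ (∷-injective tail-eq)) (trans (f-suc 0) (cong suc (sym (proj₁ (∷-injective eq)))))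

bondsBefore-sorted : ∀ w → Sorted w → bondsBefore (suc (length w)) w ≡ length w
bondsBefore-sorted w (vals-w , inc-w) =
  bonds-increasingRun suc (λ _ → refl) (length w) (w ∷ʳ (suc (length w) , plus)) vals-eq inc
  where
  vals-eq : vals (w ∷ʳ (suc (length w) , plus)) ≡ oneTo (suc (length w))
  vals-eq = trans (map-++ proj₁ w _)
                  (trans (cong (_∷ʳ suc (length w)) vals-w) (applyUpTo-∷ʳ suc (length w)))
  inc : All IncDec (decs (w ∷ʳ (suc (length w) , plus)))
  inc = subst (All IncDec) (sym (map-++ proj₂ w _)) (++⁺ inc-w ((λ ()) ∷ []))

prdLe⇒length≤ : ∀ k w → PrdLe k w → length w ≤ k + bondsBefore (suc (length w)) w
prdLe⇒length≤ k w (is , is≤k , sorted) = begin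
  length w                                         ≡⟨ subst (λ n → bondsBefore (suc n) w′ ≡ n) (length-applyRevs w is)
                                                             (bondsBefore-sorted w′ sorted) ⟨
  bondsBefore (suc (length w)) w′                  ≤⟨ bondsBefore-applyRevs (suc (length w)) w is ⟩
  length is + bondsBefore (suc (length w)) w       ≤⟨ +-monoˡ-≤ _ is≤k ⟩
  k + bondsBefore (suc (length w)) w               ∎
  where
  open ≤-Reasoning
  w′ = applyRevs w is

cleanCompact-finalBond : ∀ w x → CleanCompact w → 0 < bonds (w ∷ʳ x) →
                         ∃[ u ] ∃[ y ] (w ≡ u ∷ʳ y × Bond y x)
cleanCompact-finalBond []          x _ ()
cleanCompact-finalBond (y ∷ [])    x _ pos =
  [] , y , refl , bondCount-positive y x (subst (0 <_) (+-identityʳ _) pos)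
cleanCompact-finalBond (y ∷ z ∷ w) x (¬bond , cc) pos
  with u , y′ , eq , bond ←
         cleanCompact-finalBond (z ∷ w) x cc (subst (λ c → 0 < c + _) (bondCount-no ¬bond) pos)
  = y ∷ u , y′ , cong (y ∷_) eq , bond

bond-into-plus : ∀ {a d b} → Bond (a , d) (suc b , plus) → a ≡ b × IncDec d
bond-into-plus (inj₁ (eq , inc-d , _))  = sym (suc-injective eq) , inc-d
bond-into-plus (inj₂ (_ , _ , ¬plus))   = ⊥-elim (¬plus refl)

prdLe⇒bondBeforeSentinel : ∀ k σ → length σ ≡ suc k → PrdLe k σ → 0 < bondsBefore (suc (suc k)) σ
prdLe⇒bondBeforeSentinel k σ len prd =
  +-cancelˡ-< k 0 c (subst (_< k + c) (sym (+-identityʳ k)) k<k+c)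
  where
  c = bondsBefore (suc (suc k)) σ
  k<k+c : k < k + c
  k<k+c = subst (λ n → n ≤ k + bondsBefore (suc n) σ) len (prdLe⇒length≤ k σ prd)

cleanCompact-prdLe-endsWithMax : ∀ k σ → length σ ≡ suc k → PrdLe k σ → CleanCompact σ →
                                 ∃[ β' ] ∃[ d ] (σ ≡ β' ++ ((suc k , d) ∷ []) × d ≢ minus)
cleanCompact-prdLe-endsWithMax k σ len prd cc
  with β' , (a , d) , refl , bond ←
         cleanCompact-finalBond σ (suc (suc k) , plus) cc (prdLe⇒bondBeforeSentinel k σ len prd)
  with refl , inc-d ← bond-into-plus bond
  = β' , d , refl , inc-d

rank-∷-< : ∀ {y x} v → y < x → rank (y ∷ v) x ≡ suc (rank v x)
rank-∷-< {x = x} v y<x = cong length (filter-accept (_<? x) y<x)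

rank-∷-≮ : ∀ {y x} v → ¬ y < x → rank (y ∷ v) x ≡ rank v x
rank-∷-≮ {x = x} v y≮x = cong length (filter-reject (_<? x) y≮x)

rank-mono : ∀ {u v x z} → u ⊆ v → x ≤ z → rank u x ≤ rank v z
rank-mono {x = x} {z} u⊆v x≤z =
  length-mono-≤ (filter⁺ (_<? x) (_<? z) (λ { refl y<x → <-≤-trans y<x x≤z }) u⊆v)

rank-strict : ∀ v {z x} → z ∈ v → z < x → rank v z < rank v x
rank-strict (y ∷ v) {z} {x} (here refl) z<x = begin-strict
  rank (z ∷ v) z ≡⟨ rank-∷-≮ v (n≮n z) ⟩
  rank v z       ≤⟨ rank-mono {v} {v} ⊆-refl (<⇒≤ z<x) ⟩
  rank v x       <⟨ n<1+n (rank v x) ⟩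
  suc (rank v x) ≡⟨ rank-∷-< v z<x ⟨
  rank (z ∷ v) x ∎
  where open ≤-Reasoning
rank-strict (y ∷ v) {z} {x} (there z∈v) z<x with y <? z
... | yes y<z = begin-strict
  rank (y ∷ v) z       ≡⟨ rank-∷-< v y<z ⟩
  suc (rank v z)       <⟨ s≤s (rank-strict v z∈v z<x) ⟩
  suc (rank v x)       ≡⟨ rank-∷-< v (<-trans y<z z<x) ⟨
  rank (y ∷ v) x       ∎
  where open ≤-Reasoning
... | no y≮z = begin-strict
  rank (y ∷ v) z       ≡⟨ rank-∷-≮ v y≮z ⟩
  rank v z             <⟨ rank-strict v z∈v z<x ⟩
  rank v x             ≤⟨ rank-mono {v} {y ∷ v} (y Sublist.∷ʳ ⊆-refl) ≤-refl ⟩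
  rank (y ∷ v) x       ∎
  where open ≤-Reasoning

rank-reflects-< : ∀ v {z x} → rank v z < rank v x → z < x
rank-reflects-< v {z} {x} rz<rx with z <? x
... | yes z<x = z<x
... | no z≮x  = ⊥-elim (≤⇒≯ (rank-mono {v} {v} ⊆-refl (≮⇒≥ z≮x)) rz<rx)

rank-map : ∀ (g : ℕ → ℕ) x v → (∀ {z} → z ∈ v → g z < g x ⇔ z < x) →
           rank (map g v) (g x) ≡ rank v x
rank-map g x []      _       = refl
rank-map g x (z ∷ v) g-order with z <? x
... | yes z<x = begin
  rank (g z ∷ map g v) (g x) ≡⟨ rank-∷-< (map g v) (Equivalence.from (g-order (here refl)) z<x) ⟩
  suc (rank (map g v) (g x)) ≡⟨ cong suc (rank-map g x v (g-order ∘ there)) ⟩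
  suc (rank v x)             ≡⟨ rank-∷-< v z<x ⟨
  rank (z ∷ v) x             ∎
  where open ≡-Reasoning
... | no z≮x = begin
  rank (g z ∷ map g v) (g x) ≡⟨ rank-∷-≮ (map g v) (z≮x ∘ Equivalence.to (g-order (here refl))) ⟩
  rank (map g v) (g x)       ≡⟨ rank-map g x v (g-order ∘ there) ⟩
  rank v x                   ≡⟨ rank-∷-≮ v z≮x ⟨
  rank (z ∷ v) x             ∎
  where open ≡-Reasoning

std-idem : ∀ u → std (std u) ≡ std u
std-idem u = begin
  map (λ y → suc (rank (std u) y)) (map g u) ≡⟨ map-∘ u ⟨
  map (λ x → suc (rank (std u) (g x))) u     ≡⟨ map-cong-local (All.tabulate (cong suc ∘ rank-g)) ⟩
  map g u                                    ∎
  where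
  open ≡-Reasoning
  g : ℕ → ℕ
  g x = suc (rank u x)
  rank-g : ∀ {x} → x ∈ u → rank (map g u) (g x) ≡ rank u x
  rank-g {x} _ = rank-map g x u λ z∈u →
    mk⇔ (rank-reflects-< u ∘ ≤-pred) (s≤s ∘ rank-strict u z∈u)

rank-resp-↭ : ∀ {u v} → u ↭ v → ∀ x → rank u x ≡ rank v x
rank-resp-↭ u↭v x = ↭-length (filter-↭ (_<? x) u↭v)

std-resp-↭ : ∀ {u v} → u ↭ v → std u ↭ std v
std-resp-↭ {u} {v} u↭v = ↭-trans (↭-reflexive (map-cong (λ x → cong suc (rank-resp-↭ u↭v x)) u))
                                  (map⁺ (λ x → suc (rank v x)) u↭v)

std-strictlySorted : ∀ s → AllPairs _<_ s → std s ≡ oneTo (length s)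
std-strictlySorted []      []               = refl
std-strictlySorted (a ∷ t) (a<t ∷ sorted-t) = cong₂ _∷_ (cong suc rank-a) (begin
  map (λ x → suc (rank (a ∷ t) x)) t ≡⟨ map-cong-local (All.map (cong suc ∘ rank-∷-< t) a<t) ⟩
  map (suc ∘ suc ∘ rank t) t         ≡⟨ map-∘ t ⟩
  map suc (std t)                    ≡⟨ cong (map suc) (std-strictlySorted t sorted-t) ⟩
  map suc (oneTo (length t))         ≡⟨ map-applyUpTo suc suc (length t) ⟩
  applyUpTo (suc ∘ suc) (length t)   ∎)
  where
  open ≡-Reasoning
  rank-a : rank (a ∷ t) a ≡ 0
  rank-a = cong length (filter-none (_<? a) (n≮n a ∷ All.map <-asym a<t))

Unique⇒std↭oneTo : ∀ u → Unique u → std u ↭ oneTo (length u)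
Unique⇒std↭oneTo u unique-u = ↭-trans (std-resp-↭ (↭-sym (sort-↭ u)))
  (↭-reflexive (trans (std-strictlySorted (sort u) strict) (cong oneTo (↭-length (sort-↭ u)))))
  where
  unique-sorted : Unique (sort u)
  unique-sorted = Unique-resp-↭ (setoid ℕ) (↭⇒↭ₛ (↭-sym (sort-↭ u))) unique-u
  strict : AllPairs _<_ (sort u)
  strict = AllPairs.zipWith (uncurry ≤∧≢⇒<) (Linked⇒AllPairs ≤-trans (sort-↗ u) , unique-sorted)

map-proj₁-zip : ∀ {A B : Set} (xs : List A) (ys : List B) → length xs ≡ length ys → map proj₁ (zip xs ys) ≡ xs
map-proj₁-zip []       []       _  = refl
map-proj₁-zip (x ∷ xs) (y ∷ ys) eq = cong (x ∷_) (map-proj₁-zip xs ys (suc-injective eq))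

map-proj₂-zip : ∀ {A B : Set} (xs : List A) (ys : List B) → length xs ≡ length ys → map proj₂ (zip xs ys) ≡ ys
map-proj₂-zip []       []       _  = refl
map-proj₂-zip (x ∷ xs) (y ∷ ys) eq = cong (y ∷_) (map-proj₂-zip xs ys (suc-injective eq))

removeAt-⊆ : ∀ {A : Set} (xs : List A) i → removeAt xs i ⊆ xs
removeAt-⊆ (x ∷ xs) Fin.zero    = x Sublist.∷ʳ ⊆-refl
removeAt-⊆ (x ∷ xs) (Fin.suc i) = refl ∷ removeAt-⊆ xs i

All-removeAt : ∀ {A : Set} {P : A → Set} (xs : List A) i → All P xs → All P (removeAt xs i)
All-removeAt (x ∷ xs) Fin.zero    (_ ∷ pxs)  = pxs
All-removeAt (x ∷ xs) (Fin.suc i) (px ∷ pxs) = px ∷ All-removeAt xs i pxs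

Unique-removeAt : ∀ {A : Set} (xs : List A) i → Unique xs → Unique (removeAt xs i)
Unique-removeAt (x ∷ xs) Fin.zero    (_ ∷ u)   = u
Unique-removeAt (x ∷ xs) (Fin.suc i) (x∉ ∷ u) = All-removeAt xs i x∉ ∷ Unique-removeAt xs i u

Unique-oneTo : ∀ n → Unique (oneTo n)
Unique-oneTo n = applyUpTo⁺₁ suc n (λ i<j _ → <⇒≢ i<j ∘ suc-injective)

module _ (w : Word) (i : Fin (length w)) where

  private
    w′ = removeAt w i

    length-std≡length-decs : length (std (vals w′)) ≡ length (decs w′)
    length-std≡length-decs = trans (length-map _ (vals w′)) (trans (length-map proj₁ w′) (sym (length-map proj₂ w′)))

  vals-deleteStd : vals (deleteStd w i) ≡ std (vals w′)
  vals-deleteStd = map-proj₁-zip (std (vals w′)) (decs w′) length-std≡length-decs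

  decs-deleteStd : decs (deleteStd w i) ≡ decs w′
  decs-deleteStd = map-proj₂-zip (std (vals w′)) (decs w′) length-std≡length-decs

  length-deleteStd : length (deleteStd w i) ≡ length (vals w′)
  length-deleteStd = begin
    length (deleteStd w i)        ≡⟨ length-map proj₁ (deleteStd w i) ⟨
    length (vals (deleteStd w i)) ≡⟨ cong length vals-deleteStd ⟩
    length (std (vals w′))        ≡⟨ length-map _ (vals w′) ⟩
    length (vals w′)              ∎
    where open ≡-Reasoning

  length-deleteStd-pred : length (deleteStd w i) ≡ pred (length w)
  length-deleteStd-pred = trans length-deleteStd (trans (length-map proj₁ w′) (length-removeAt w i))

  isPeg-deleteStd : IsPeg w → IsPeg (deleteStd w i)
  isPeg-deleteStd peg = subst₂ _↭_ (sym vals-deleteStd) (cong oneTo (sym length-deleteStd))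
                                   (Unique⇒std↭oneTo (vals w′) unique-w′)
    where
    unique-w : Unique (vals w)
    unique-w = Unique-resp-↭ (setoid ℕ) (↭⇒↭ₛ (↭-sym peg)) (Unique-oneTo (length w))
    unique-w′ : Unique (vals w′)
    unique-w′ = subst Unique (sym (map-removeAt w i proj₁)) (Unique-removeAt (vals w) _ unique-w)

  deleteStd-isPattern : IsPattern (deleteStd w i) w
  deleteStd-isPattern =
    w′ , removeAt-⊆ w i , sym (trans (cong std vals-deleteStd) (std-idem (vals w′))) ,
    subst (Pointwise DecoOK (decs (deleteStd w i))) decs-deleteStd (Pointwise.refl decoOK-refl)
    where
    decoOK-refl : ∀ {d} → DecoOK d d
    decoOK-refl {plus}  = refl
    decoOK-refl {minus} = refl
    decoOK-refl {dot}   = _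

deleteStd-≢ : ∀ w i → deleteStd w i ≢ w
deleteStd-≢ (x ∷ w) i eq = 1+n≢n (trans (sym (cong length eq)) (length-deleteStd-pred (x ∷ w) i))

mainTheorem19 : (k : ℕ) (π : Word) → length π ≡ k + 2 → InCCBasis k π →
    (i : Fin (length π)) → CleanCompact (deleteStd π i) →
    ∃[ β' ] ∃[ d ] (deleteStd π i ≡ β' ++ ((suc k , d) ∷ []) × d ≢ minus)
mainTheorem19 k π len (peg , _ , _ , properPatternsInB) i cc =
  cleanCompact-prdLe-endsWithMax k σ length-σ (proj₂ σ∈B) cc
  where
  σ = deleteStd π i
  length-σ : length σ ≡ suc k
  length-σ = trans (length-deleteStd-pred π i) (cong pred (trans len (+-comm k 2)))
  σ∈B : InB k σ
  σ∈B = properPatternsInB σ (isPeg-deleteStd π i peg) cc (deleteStd-isPattern π i) (deleteStd-≢ π i)
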